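{- Let $k \geq 1$ be an integer and let $G$ be a graph without isolated vertices. Then $\gamma_{k}^t(G) \geq \mathrm{sub}_k^t(G)$.
   Context: All graphs are finite and simple; $d_G(u,v)$ is the length of a shortest $(u,v)$-path in $G$, and for $S \subseteq V(G)$, $d_G(v,S)=\min_{w\in S} d_G(v,w)$. For an integer $k\ge 1$ and a graph $G$ without isolated vertices, a set $S\subseteq V(G)$ is a total $k$-dominating set of $G$ if $d_G(v, S\setminus\{v\}) \le k$ for every $v \in V(G)$; the total $k$-domination number $\gamma_k^t(G)$ is the minimum cardinality of such a set. The $k$-neighborhood of $v$ is $N_{G,k}(v)=\{w : 1\le d_G(v,w)\le k\}$ and the $k$-degree of $v$ is $d_{G,k}(v)=|N_{G,k}(v)|$. If $G$ has order $n$, its $k$-degree sequence is the list $d_k^1 \ge d_k^2 \ge \dots \ge d_k^n$ of the $k$-degrees of all vertices in nonincreasing order. The sub-total $k$-domination number is $\mathrm{sub}_k^t(G)=\min\{ j : \sum_{i=1}^{j} d_k^i \ge n\}$. -}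

module Defs where

open import Data.Nat using (ℕ; zero; suc; _≤_; _<_; _≥_)
open import Data.Bool using (Bool; true; false; _∧_; _∨_; not)
open import Data.Fin using (Fin; _≟_)
open import Data.Fin.Subset using (Subset; _∈_; ∣_∣)
open import Data.List using (List; allFin; map; take)
open import Data.Bool.ListAction using (any)
open import Data.Nat.ListAction using (sum)
open import Data.List.Relation.Binary.Permutation.Propositional using (_↭_)
open import Data.List.Relation.Unary.Linked using (Linked)
open import Data.Vec using (tabulate)
open import Data.Product using (∃; _×_)
open import Relation.Nullary using (¬_)
open import Relation.Nullary.Decidable using (isYes)
open import Relation.Binary.PropositionalEquality using (_≡_; _≢_)

record Graph (n : ℕ) : Set where
  field
    adj    : Fin n → Fin n → Bool
    sym    : ∀ u v → adj u v ≡ adj v u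
    irrefl : ∀ v → adj v v ≡ false
open Graph public

NoIsolated : ∀ {n} → Graph n → Set
NoIsolated {n} G = ∀ (v : Fin n) → ∃ λ w → adj G v w ≡ true

-- within G k u v = true  iff  d_G(u,v) ≤ k, i.e. there is a (u,v)-walk of
-- length at most k (walks of length ≤ k extended by one edge).
within : ∀ {n} → Graph n → ℕ → Fin n → Fin n → Bool
within G zero    u v = isYes (u ≟ v)
within {n} G (suc k) u v =
  within G k u v ∨ any (λ w → within G k u w ∧ adj G w v) (allFin n)

IsTotalKDom : ∀ {n} → Graph n → ℕ → Subset n → Set
IsTotalKDom {n} G k S =
  ∀ (v : Fin n) → ∃ λ w → w ∈ S × w ≢ v × within G k v w ≡ true

IsTotalKDomNumber : ∀ {n} → Graph n → ℕ → ℕ → Set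
IsTotalKDomNumber G k g =
  (∃ λ S → IsTotalKDom G k S × ∣ S ∣ ≡ g)
  × (∀ S → IsTotalKDom G k S → g ≤ ∣ S ∣)

kNeighbourhood : ∀ {n} → Graph n → ℕ → Fin n → Subset n
kNeighbourhood G k v = tabulate (λ w → not (isYes (w ≟ v)) ∧ within G k v w)

kDegree : ∀ {n} → Graph n → ℕ → Fin n → ℕ
kDegree G k v = ∣ kNeighbourhood G k v ∣

IsKDegreeSequence : ∀ {n} → Graph n → ℕ → List ℕ → Set
IsKDegreeSequence {n} G k ds =
  ds ↭ map (kDegree G k) (allFin n) × Linked _≥_ ds

IsSubTotalKDomNumber : ∀ {n} → Graph n → ℕ → ℕ → Set
IsSubTotalKDomNumber {n} G k j =
  ∃ λ ds → IsKDegreeSequence G k ds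
    × n ≤ sum (take j ds)
    × (∀ i → i < j → ¬ (n ≤ sum (take i ds)))

-- A vertex v is k-dominated by some w ∈ S with w ≠ v, and then v lies in the
-- k-neighbourhood of w (distance is symmetric). So the k-neighbourhoods of the
-- members of a total k-dominating set S cover V(G), whence n is at most the
-- sum of the k-degrees of the members of S, which in turn is at most the sum of
-- the ∣S∣ largest k-degrees. By minimality of sub_k^t this gives sub_k^t ≤ ∣S∣.
module Submission where

open import Defs
open import Data.Nat using (ℕ; zero; suc; _+_; _≤_; _≥_; z≤n; s≤s)
open import Data.Nat.Properties using (≤-trans; ≤-reflexive; +-mono-≤; +-monoʳ-≤; +-suc; n≤1+n; ≮⇒≥; module ≤-Reasoning)
open import Data.Bool using (true; false; _∧_; not)
open import Data.Bool.Properties using (T-≡; T-∧)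
open import Data.Fin using (Fin; zero; suc; _≟_)
open import Data.Fin.Subset using (Subset; _∈_; ∣_∣; _∪_; ⊤; ⋃)
open import Data.Fin.Subset.Properties using (∣⊤∣≡n; ∣⊥∣≡0; p⊆q⇒∣p∣≤∣q∣; x∈p∪q⁺)
open import Data.List using (List; []; _∷_; _++_; length; take; allFin; map; tabulate)
open import Data.List.Properties using (map-tabulate)
open import Data.List.Relation.Unary.Any using (here; there; satisfied)
open import Data.List.Relation.Unary.Any.Properties using (any⁺; any⁻)
open import Data.List.Membership.Propositional using (lose) renaming (_∈_ to _∈ₗ_)
open import Data.List.Membership.Propositional.Properties using (∈-allFin; ∈-++⁻; ∈-∃++)
open import Data.List.Relation.Binary.Permutation.Propositional
open import Data.List.Relation.Binary.Permutation.Propositional.Properties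
  using (shift; drop-∷; ++⁺ˡ; ++⁺ʳ; ∈-resp-↭; ¬x∷xs↭[]; ↭-length)
open import Data.List.Relation.Unary.Linked as Linked using (Linked; _∷_)
open import Data.Nat.ListAction using (sum)
open import Data.Nat.ListAction.Properties using (sum-↭)
open import Data.Vec.Properties using (lookup⇒[]=; lookup∘tabulate)
open import Data.Vec using ([]; _∷_; here; there)
open import Data.Product using (∃; _×_; _,_)
open import Data.Sum using (_⊎_; inj₁; inj₂)
open import Data.Empty using (⊥-elim)
open import Function.Base using (_∘_; id)
open import Function.Bundles using (Equivalence)
open import Relation.Nullary.Decidable using (isYes; isYes≗does; dec-true; dec-false; toWitness)
open import Relation.Binary.PropositionalEquality
  using (_≡_; _≢_; refl; cong; cong₂; subst; subst₂) renaming (sym to ≡-sym; trans to ≡-trans)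

open Equivalence using (to; from)

module _ {n : ℕ} (G : Graph n) where

  within-zero⁻ : ∀ {u v} → within G 0 u v ≡ true → u ≡ v
  within-zero⁻ e = toWitness (from T-≡ e)

  within-zero⁺ : ∀ u → within G 0 u u ≡ true
  within-zero⁺ u = ≡-trans (isYes≗does (u ≟ u)) (dec-true (u ≟ u) refl)

  within-suc : ∀ k {u v} → within G k u v ≡ true → within G (suc k) u v ≡ true
  within-suc k e rewrite e = refl

  within-snoc : ∀ k {u w v} → within G k u w ≡ true → adj G w v ≡ true →
                within G (suc k) u v ≡ true
  within-snoc k {u} {w} {v} uw wv with within G k u v
  ... | true  = refl
  ... | false = to T-≡ (any⁺ _ (lose (∈-allFin w) (from T-∧ (from T-≡ uw , from T-≡ wv))))

  within-suc⁻ : ∀ k {u v} → within G (suc k) u v ≡ true →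
                within G k u v ≡ true ⊎ ∃ λ w → within G k u w ≡ true × adj G w v ≡ true
  within-suc⁻ k {u} {v} e with within G k u v
  ... | true  = inj₁ refl
  ... | false with satisfied (any⁻ _ (allFin n) (from T-≡ e))
  ...   | w , t with to T-∧ t
  ...     | uw , wv = inj₂ (w , to T-≡ uw , to T-≡ wv)

  -- `within` extends walks at their end; symmetry needs extension at their start.
  within-cons : ∀ k {u x v} → adj G u x ≡ true → within G k x v ≡ true →
                within G (suc k) u v ≡ true
  within-cons zero {u} ux xv with within-zero⁻ xv
  ... | refl = within-snoc zero (within-zero⁺ u) ux
  within-cons (suc k) ux xv with within-suc⁻ k xv
  ... | inj₁ xv′           = within-suc (suc k) (within-cons k ux xv′)
  ... | inj₂ (w , xw , wv) = within-snoc (suc k) (within-cons k ux xw) wv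

  within-sym : ∀ k {u v} → within G k u v ≡ true → within G k v u ≡ true
  within-sym zero e with within-zero⁻ e
  ... | refl = e
  within-sym (suc k) {u} {v} e with within-suc⁻ k e
  ... | inj₁ uv            = within-suc k (within-sym k uv)
  ... | inj₂ (w , uw , wv) = within-cons k (≡-trans (Graph.sym G v w) wv) (within-sym k uw)

  ∈-kNeighbourhood : ∀ k {v w} → w ≢ v → within G k v w ≡ true → w ∈ kNeighbourhood G k v
  ∈-kNeighbourhood k {v} {w} w≢v vw =
    lookup⇒[]= w _ (≡-trans (lookup∘tabulate _ w) (cong₂ _∧_ w≠v vw))
    where
    w≠v : not (isYes (w ≟ v)) ≡ true
    w≠v = cong not (≡-trans (isYes≗does (w ≟ v)) (dec-false (w ≟ v) w≢v))

module _ {A : Set} where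

  select : ∀ {n} → Subset n → (Fin n → A) → List A
  select []          f = []
  select (true  ∷ S) f = f zero ∷ select S (f ∘ suc)
  select (false ∷ S) f = select S (f ∘ suc)

  reject : ∀ {n} → Subset n → (Fin n → A) → List A
  reject []          f = []
  reject (true  ∷ S) f = reject S (f ∘ suc)
  reject (false ∷ S) f = f zero ∷ reject S (f ∘ suc)

  select++reject↭tabulate : ∀ {n} (S : Subset n) (f : Fin n → A) →
                            select S f ++ reject S f ↭ tabulate f
  select++reject↭tabulate []          f = refl
  select++reject↭tabulate (true  ∷ S) f = prep (f zero) (select++reject↭tabulate S (f ∘ suc))
  select++reject↭tabulate (false ∷ S) f =
    trans (shift (f zero) (select S (f ∘ suc)) (reject S (f ∘ suc)))
          (prep (f zero) (select++reject↭tabulate S (f ∘ suc)))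

  length-select : ∀ {n} (S : Subset n) (f : Fin n → A) → length (select S f) ≡ ∣ S ∣
  length-select []          f = refl
  length-select (true  ∷ S) f = cong suc (length-select S (f ∘ suc))
  length-select (false ∷ S) f = length-select S (f ∘ suc)

  ∈-select : ∀ {n} {S : Subset n} {w} (f : Fin n → A) → w ∈ S → f w ∈ₗ select S f
  ∈-select {S = true ∷ S}  f here        = here refl
  ∈-select {S = true ∷ S}  f (there w∈S) = there (∈-select (f ∘ suc) w∈S)
  ∈-select {S = false ∷ S} f (there w∈S) = ∈-select (f ∘ suc) w∈S

map-select : ∀ {A B : Set} {n} (S : Subset n) (f : Fin n → A) (g : A → B) →
             map g (select S f) ≡ select S (g ∘ f)
map-select []          f g = refl
map-select (true  ∷ S) f g = cong (g (f zero) ∷_) (map-select S (f ∘ suc) g)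
map-select (false ∷ S) f g = map-select S (f ∘ suc) g

∣p∪q∣≤∣p∣+∣q∣ : ∀ {n} (p q : Subset n) → ∣ p ∪ q ∣ ≤ ∣ p ∣ + ∣ q ∣
∣p∪q∣≤∣p∣+∣q∣ []          []          = z≤n
∣p∪q∣≤∣p∣+∣q∣ (true  ∷ p) (true  ∷ q) =
  s≤s (≤-trans (∣p∪q∣≤∣p∣+∣q∣ p q) (+-monoʳ-≤ ∣ p ∣ (n≤1+n ∣ q ∣)))
∣p∪q∣≤∣p∣+∣q∣ (true  ∷ p) (false ∷ q) = s≤s (∣p∪q∣≤∣p∣+∣q∣ p q)
∣p∪q∣≤∣p∣+∣q∣ (false ∷ p) (true  ∷ q) =
  subst (suc ∣ p ∪ q ∣ ≤_) (≡-sym (+-suc ∣ p ∣ ∣ q ∣)) (s≤s (∣p∪q∣≤∣p∣+∣q∣ p q))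
∣p∪q∣≤∣p∣+∣q∣ (false ∷ p) (false ∷ q) = ∣p∪q∣≤∣p∣+∣q∣ p q

∣⋃L∣≤sum∣L∣ : ∀ {n} (L : List (Subset n)) → ∣ ⋃ L ∣ ≤ sum (map ∣_∣ L)
∣⋃L∣≤sum∣L∣ {n} []   = ≤-reflexive (∣⊥∣≡0 n)
∣⋃L∣≤sum∣L∣ (p ∷ L) = ≤-trans (∣p∪q∣≤∣p∣+∣q∣ p (⋃ L)) (+-monoʳ-≤ ∣ p ∣ (∣⋃L∣≤sum∣L∣ L))

x∈p∈L⇒x∈⋃L : ∀ {n} {x : Fin n} {p} {L : List (Subset n)} → p ∈ₗ L → x ∈ p → x ∈ ⋃ L
x∈p∈L⇒x∈⋃L (here refl) x∈p = x∈p∪q⁺ (inj₁ x∈p)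
x∈p∈L⇒x∈⋃L (there p∈L) x∈p = x∈p∪q⁺ (inj₂ (x∈p∈L⇒x∈⋃L p∈L x∈p))

∈⇒↭∷ : ∀ {A : Set} {x : A} {xs} → x ∈ₗ xs → ∃ λ xs′ → xs ↭ x ∷ xs′
∈⇒↭∷ x∈xs with as , bs , refl ← ∈-∃++ x∈xs = as ++ bs , shift _ as bs

sum-take-≤-cons : ∀ {d ds} → Linked _≥_ (d ∷ ds) → ∀ m → sum (take m ds) ≤ sum (take m (d ∷ ds))
sum-take-≤-cons                  _           zero    = z≤n
sum-take-≤-cons {ds = []}        _           (suc m) = z≤n
sum-take-≤-cons {ds = e ∷ es}    (d≥e ∷ des) (suc m) = +-mono-≤ d≥e (sum-take-≤-cons des m)

-- Remove the head d of ds from whichever of xs, ys contains it and recurse; when it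
-- is in ys, sortedness lets the prefix of ds be bounded by that of d ∷ ds.
sum≤sum-take-sorted : ∀ {ds} → Linked _≥_ ds → ∀ xs ys → xs ++ ys ↭ ds →
                      sum xs ≤ sum (take (length xs) ds)
sum≤sum-take-sorted {[]}     _      []      ys _ = z≤n
sum≤sum-take-sorted {[]}     _      (x ∷ _) ys p = ⊥-elim (¬x∷xs↭[] p)
sum≤sum-take-sorted {d ∷ ds} sorted xs      ys p with ∈-++⁻ xs (∈-resp-↭ (↭-sym p) (here refl))
... | inj₁ d∈xs with xs′ , xs↭ ← ∈⇒↭∷ d∈xs =
  subst₂ (λ s l → s ≤ sum (take l (d ∷ ds))) (≡-sym (sum-↭ xs↭)) (≡-sym (↭-length xs↭))
    (+-monoʳ-≤ d (sum≤sum-take-sorted (Linked.tail sorted) xs′ ys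
      (drop-∷ (trans (↭-sym (++⁺ʳ ys xs↭)) p))))
... | inj₂ d∈ys with ys′ , ys↭ ← ∈⇒↭∷ d∈ys =
  ≤-trans (sum≤sum-take-sorted (Linked.tail sorted) xs ys′
            (drop-∷ (trans (↭-sym (trans (++⁺ˡ xs ys↭) (shift d xs ys′))) p)))
          (sum-take-≤-cons sorted (length xs))

module _ {n : ℕ} (G : Graph n) (k : ℕ) where

  n≤sum-kDegree-select : ∀ {S} → IsTotalKDom G k S → n ≤ sum (select S (kDegree G k))
  n≤sum-kDegree-select {S} S-dom = begin
    n                                               ≡⟨ ∣⊤∣≡n n ⟨
    ∣ ⊤ {n} ∣                                       ≤⟨ p⊆q⇒∣p∣≤∣q∣ {p = ⊤} (λ {v} _ → covered v) ⟩
    ∣ ⋃ (select S (kNeighbourhood G k)) ∣           ≤⟨ ∣⋃L∣≤sum∣L∣ (select S (kNeighbourhood G k)) ⟩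
    sum (map ∣_∣ (select S (kNeighbourhood G k)))   ≡⟨ cong sum (map-select S (kNeighbourhood G k) ∣_∣) ⟩
    sum (select S (kDegree G k))                    ∎
    where
    open ≤-Reasoning
    covered : ∀ v → v ∈ ⋃ (select S (kNeighbourhood G k))
    covered v with w , w∈S , w≢v , vw ← S-dom v =
      x∈p∈L⇒x∈⋃L (∈-select (kNeighbourhood G k) w∈S)
                 (∈-kNeighbourhood G k (w≢v ∘ ≡-sym) (within-sym G k vw))

-- The hypotheses k ≥ 1 and NoIsolated G only guarantee that g exists.
theorem3p1 : ∀ {n : ℕ} (k : ℕ) (G : Graph n) → 1 ≤ k → NoIsolated G →
    ∀ (g j : ℕ) → IsTotalKDomNumber G k g → IsSubTotalKDomNumber G k j →
    j ≤ g
theorem3p1 {n} k G _ _ g j ((S , S-dom , ∣S∣≡g) , _) (ds , (ds↭ , ds-sorted) , _ , j-minimal) =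
  ≮⇒≥ λ g<j → j-minimal g g<j n≤sum-take-g
  where
  open ≤-Reasoning
  degrees : Fin n → ℕ
  degrees = kDegree G k
  split : select S degrees ++ reject S degrees ↭ ds
  split = trans (select++reject↭tabulate S degrees)
                (trans (↭-reflexive (≡-sym (map-tabulate id degrees))) (↭-sym ds↭))
  n≤sum-take-g : n ≤ sum (take g ds)
  n≤sum-take-g = begin
    n                                                ≤⟨ n≤sum-kDegree-select G k S-dom ⟩
    sum (select S degrees)                           ≤⟨ sum≤sum-take-sorted ds-sorted (select S degrees) _ split ⟩
    sum (take (length (select S degrees)) ds)        ≡⟨ cong (λ m → sum (take m ds)) (≡-trans (length-select S degrees) ∣S∣≡g) ⟩
    sum (take g ds)                                  ∎
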